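{- Let $(\mathbb T,M,(-)^\circ,m)$ be an idealized monad on a category $\mathbf C$ with finite coproducts. Then: (1) $\mathbb T$ becomes an abstractly guarded monad when equipped with weak guardedness as the notion of abstract guardedness. (2) If $\mathbb T$ is completely iterative, then every weakly $\mathrm{inr}$-guarded morphism $f\colon X\to T(Y+X)$ has a unique solution, i.e. a unique $f^\dagger\colon X\to TY$ with $f^\dagger=[\eta,f^\dagger]^*\circ f$. (3) If $(\alpha,\beta)$ is an idealized monad morphism from $\mathbb T$ to another idealized monad, then $\alpha$ preserves weak guardedness: if $f\colon X\to TY$ is weakly $\sigma$-guarded then so is $\alpha_Y\circ f$.
   Context: $\mathbb T=(T,\eta,(-)^*)$ is a monad in Kleisli-triple form. A module over $\mathbb T$ is $(M,(-)^\circ)$ with $M$ a map on objects and $(-)^\circ\colon\mathrm{Hom}(X,TY)\to\mathrm{Hom}(MX,MY)$ satisfying $\eta^\circ=\mathrm{id}$ and $g^\circ\circ f^\circ=(g^*\circ f)^\circ$ (so $M$ is a functor via $Mf=(\eta f)^\circ$). A module-to-monad morphism is a natural $m\colon M\to T$ with $m\circ f^\circ=f^*\circ m$. An idealized monad is $(\mathbb T,M,(-)^\circ,m)$. An idealized monad morphism $(\alpha,\beta)$ from $(\mathbb T,M,(-)^\circ,m)$ to $(\mathbb S,N,(-)^\bullet,m')$ consists of a monad morphism $\alpha\colon T\to S$ and a natural $\beta\colon M\to N$ with $\alpha\circ m=m'\circ\beta$ and $\beta\circ f^\circ=(\alpha\circ f)^\bullet\circ\beta$. A morphism $f\colon X\to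 T(Y+Z)$ is guarded if it factors through $[\eta\circ\mathrm{inl},m]\colon Y+M(Y+Z)\to T(Y+Z)$; $\mathbb T$ is completely iterative if every guarded $f\colon X\to T(Y+X)$ has a unique solution. For a summand $\sigma\colon Z\triangleleft Y$ (a pair exhibiting $Y$ as coproduct, identified with its first injection) with complement $\bar\sigma\colon Y'\triangleleft Y$, $f\colon X\to TY$ is weakly $\sigma$-guarded if it factors through $[\eta\circ\bar\sigma,m_Y]^*\colon T(Y'+MY)\to TY$. A monad is abstractly guarded if it has a relation $f\colon X\to_\sigma TY$ closed under (trv) $T(\mathrm{inl})\circ f\colon X\to_{\mathrm{inr}}T(Y+Z)$ for all $f\colon X\to TY$; (par) $f\colon X\to_\sigma TZ$, $g\colon Y\to_\sigma TZ$ imply $[f,g]\colon X+Y\to_\sigma TZ$; (cmp) $f\colon X\to_{\mathrm{inr}}T(Y+Z)$, $g\colon Y\to_\sigma TV$, $h\colon Z\to TV$ imply $[g,h]^*\circ f\colon X\to_\sigma TV$. -}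

module Defs where

open import Level using (Level; _⊔_) renaming (suc to lsuc)
open import Relation.Binary using (Rel; IsEquivalence)
open import Data.Product using (Σ; _×_; _,_)

record Category (o ℓ e : Level) : Set (lsuc (o ⊔ ℓ ⊔ e)) where
  infixr 9 _∘_
  infix 4 _≈_
  field
    Obj       : Set o
    Hom       : Obj → Obj → Set ℓ
    _≈_       : ∀ {A B} → Rel (Hom A B) e
    id        : ∀ {A} → Hom A A
    _∘_       : ∀ {A B C} → Hom B C → Hom A B → Hom A C
    ≈-equiv   : ∀ {A B} → IsEquivalence (_≈_ {A} {B})
    ∘-resp-≈  : ∀ {A B C} {f f' : Hom B C} {g g' : Hom A B} →
                f ≈ f' → g ≈ g' → f ∘ g ≈ f' ∘ g'
    identityˡ : ∀ {A B} {f : Hom A B} → id ∘ f ≈ f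
    identityʳ : ∀ {A B} {f : Hom A B} → f ∘ id ≈ f
    assoc     : ∀ {A B C D} {f : Hom A B} {g : Hom B C} {h : Hom C D} →
                (h ∘ g) ∘ f ≈ h ∘ (g ∘ f)

module _ {o ℓ e : Level} (C : Category o ℓ e) where
  open Category C

  record IsCoproduct {A B : Obj} (P : Obj) (i₁ : Hom A P) (i₂ : Hom B P)
         : Set (o ⊔ ℓ ⊔ e) where
    field
      copair  : ∀ {W} → Hom A W → Hom B W → Hom P W
      inject₁ : ∀ {W} {f : Hom A W} {g : Hom B W} → copair f g ∘ i₁ ≈ f
      inject₂ : ∀ {W} {f : Hom A W} {g : Hom B W} → copair f g ∘ i₂ ≈ g
      unique  : ∀ {W} {f : Hom A W} {g : Hom B W} {h : Hom P W} →
                h ∘ i₁ ≈ f → h ∘ i₂ ≈ g → h ≈ copair f g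

  record FiniteCoproducts : Set (o ⊔ ℓ ⊔ e) where
    infixr 6 _+_
    field
      ⊥        : Obj
      ¡        : ∀ {A} → Hom ⊥ A
      ¡-unique : ∀ {A} (h : Hom ⊥ A) → h ≈ ¡
      _+_      : Obj → Obj → Obj
      inl      : ∀ {A B} → Hom A (A + B)
      inr      : ∀ {A B} → Hom B (A + B)
      +-isCoproduct : ∀ {A B} → IsCoproduct (A + B) (inl {A} {B}) (inr {A} {B})

    [_,_] : ∀ {A B W} → Hom A W → Hom B W → Hom (A + B) W
    [ f , g ] = IsCoproduct.copair +-isCoproduct f g

  -- A summand σ : Z ◁ Y : a pair (σ, σ̄) exhibiting Y as a coproduct Z + Y'
  -- (σ the first injection, σ̄ : Y' → Y its complement)
  record Summand (Z Y : Obj) : Set (o ⊔ ℓ ⊔ e) where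
    field
      Y'            : Obj
      σ             : Hom Z Y
      σ̄             : Hom Y' Y
      isCoproduct   : IsCoproduct Y σ σ̄

  module _ (CP : FiniteCoproducts) where
    open FiniteCoproducts CP

    inrSummand : ∀ {Y Z} → Summand Z (Y + Z)
    inrSummand {Y} {Z} = record
      { Y' = Y ; σ = inr ; σ̄ = inl
      ; isCoproduct = record
        { copair  = λ f g → [ g , f ]
        ; inject₁ = IsCoproduct.inject₂ +-isCoproduct
        ; inject₂ = IsCoproduct.inject₁ +-isCoproduct
        ; unique  = λ p q → IsCoproduct.unique +-isCoproduct q p
        }
      }

  record KleisliTriple : Set (o ⊔ ℓ ⊔ e) where
    infix 10 _*
    field
      T        : Obj → Obj
      η        : ∀ {X} → Hom X (T X)
      _*       : ∀ {X Y} → Hom X (T Y) → Hom (T X) (T Y)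
      *-resp-≈ : ∀ {X Y} {f g : Hom X (T Y)} → f ≈ g → f * ≈ g *
      η*       : ∀ {X} → η {X} * ≈ id
      *-η      : ∀ {X Y} {f : Hom X (T Y)} → f * ∘ η ≈ f
      *-∘      : ∀ {X Y Z} {f : Hom X (T Y)} {g : Hom Y (T Z)} →
                 g * ∘ f * ≈ (g * ∘ f) *

    Tmap : ∀ {X Y} → Hom X Y → Hom (T X) (T Y)
    Tmap f = (η ∘ f) *

  record Module (𝕋 : KleisliTriple) : Set (o ⊔ ℓ ⊔ e) where
    open KleisliTriple 𝕋
    infix 10 _°
    field
      M        : Obj → Obj
      _°       : ∀ {X Y} → Hom X (T Y) → Hom (M X) (M Y)
      °-resp-≈ : ∀ {X Y} {f g : Hom X (T Y)} → f ≈ g → f ° ≈ g °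
      η°       : ∀ {X} → η {X} ° ≈ id
      °-∘      : ∀ {X Y Z} {f : Hom X (T Y)} {g : Hom Y (T Z)} →
                 g ° ∘ f ° ≈ (g * ∘ f) °

    Mmap : ∀ {X Y} → Hom X Y → Hom (M X) (M Y)
    Mmap f = (η ∘ f) °

  record ModuleToMonad (𝕋 : KleisliTriple) (𝕄 : Module 𝕋) : Set (o ⊔ ℓ ⊔ e) where
    open KleisliTriple 𝕋
    open Module 𝕄
    field
      m       : ∀ {X} → Hom (M X) (T X)
      natural : ∀ {X Y} (f : Hom X Y) → m ∘ Mmap f ≈ Tmap f ∘ m
      commute : ∀ {X Y} (f : Hom X (T Y)) → m ∘ f ° ≈ f * ∘ m

  record IdealizedMonad : Set (o ⊔ ℓ ⊔ e) where
    field
      monad  : KleisliTriple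
      mod    : Module monad
      ideal  : ModuleToMonad monad mod
    open KleisliTriple monad public
    open Module mod public
    open ModuleToMonad ideal public

  record MonadMorphism (𝕋 𝕊 : KleisliTriple) : Set (o ⊔ ℓ ⊔ e) where
    private
      module T = KleisliTriple 𝕋
      module S = KleisliTriple 𝕊
    field
      α       : ∀ {X} → Hom (T.T X) (S.T X)
      natural : ∀ {X Y} (f : Hom X Y) → α ∘ T.Tmap f ≈ S.Tmap f ∘ α
      unit    : ∀ {X} → α ∘ T.η {X} ≈ S.η
      mult    : ∀ {X Y} (f : Hom X (T.T Y)) → α ∘ f T.* ≈ (α ∘ f) S.* ∘ α

  record IdealizedMonadMorphism (I J : IdealizedMonad) : Set (o ⊔ ℓ ⊔ e) where
    private
      module I = IdealizedMonad I
      module J = IdealizedMonad J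
    field
      monadMorphism : MonadMorphism I.monad J.monad
    open MonadMorphism monadMorphism public
    field
      β         : ∀ {X} → Hom (I.M X) (J.M X)
      β-natural : ∀ {X Y} (f : Hom X Y) → β ∘ I.Mmap f ≈ J.Mmap f ∘ β
      α-m       : ∀ {X} → α {X} ∘ I.m ≈ J.m ∘ β
      β-°       : ∀ {X Y} (f : Hom X (I.T Y)) → β ∘ f I.° ≈ (α ∘ f) J.° ∘ β

  module _ (CP : FiniteCoproducts) where
    open FiniteCoproducts CP

    record IsAbstractGuardedness {r : Level} (𝕋 : KleisliTriple)
           (G : ∀ {X Y Z} → Summand Z Y → Hom X (KleisliTriple.T 𝕋 Y) → Set r)
           : Set (o ⊔ ℓ ⊔ e ⊔ r) where
      open KleisliTriple 𝕋
      field
        trv : ∀ {X Y Z} (f : Hom X (T Y)) →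
              G (inrSummand CP {Y} {Z}) (Tmap inl ∘ f)
        par : ∀ {X Y Z W} {σ : Summand W Z} {f : Hom X (T Z)} {g : Hom Y (T Z)} →
              G σ f → G σ g → G σ [ f , g ]
        cmp : ∀ {X Y Z V W} {σ : Summand W V} {f : Hom X (T (Y + Z))}
                {g : Hom Y (T V)} {h : Hom Z (T V)} →
              G (inrSummand CP) f → G σ g → G σ ([ g , h ] * ∘ f)

    module _ (I : IdealizedMonad) where
      open IdealizedMonad I

      WeaklyGuarded : ∀ {X Y Z} → Summand Z Y → Hom X (T Y) → Set (ℓ ⊔ e)
      WeaklyGuarded {X} {Y} σ f =
        Σ (Hom X (T (Summand.Y' σ + M Y)))
          (λ g → f ≈ [ η ∘ Summand.σ̄ σ , m ] * ∘ g)

      Guarded : ∀ {X Y Z} → Hom X (T (Y + Z)) → Set (ℓ ⊔ e)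
      Guarded {X} {Y} {Z} f =
        Σ (Hom X (Y + M (Y + Z))) (λ g → f ≈ [ η ∘ inl , m ] ∘ g)

      IsSolution : ∀ {X Y} → Hom X (T (Y + X)) → Hom X (T Y) → Set e
      IsSolution f s = s ≈ [ η , s ] * ∘ f

      HasUniqueSolution : ∀ {X Y} → Hom X (T (Y + X)) → Set (ℓ ⊔ e)
      HasUniqueSolution {X} {Y} f =
        Σ (Hom X (T Y)) (λ s → IsSolution f s × (∀ s' → IsSolution f s' → s' ≈ s))

      CompletelyIterative : Set (o ⊔ ℓ ⊔ e)
      CompletelyIterative =
        ∀ {X Y} (f : Hom X (T (Y + X))) → Guarded f → HasUniqueSolution f

-- A weakly σ-guarded map has the form [η ∘ σ̄ , m]* ∘ g. Such maps include η ∘ σ̄ and every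
-- m ∘ k, they are closed under copairing, and they are closed under u* ∘ - whenever u is weakly
-- guarded, because [η ∘ σ̄ , m]* is itself a Kleisli extension. The closure axioms follow, and so
-- does preservation, since α ∘ [η ∘ σ̄ , m]* = [η ∘ σ̄ , m ∘ β]* ∘ α. For (2), a weakly guarded
-- f = [η ∘ inl , m]* ∘ g is traded for the guarded map m ∘ [η ∘ inl , g]° on M(Y + X), whose
-- solutions correspond to those of f through s ↦ m ∘ [η , s]° and t ↦ [η , t]* ∘ g.
module Submission where

open import Defs
open import Level using (Level)
open import Data.Product using (_×_; _,_)
open import Relation.Binary using (IsEquivalence; Setoid)
import Relation.Binary.Reasoning.Setoid as SetoidReasoning

module CategoryFacts {o ℓ e : Level} (C : Category o ℓ e) where
  open Category C

  hom-setoid : Obj → Obj → Setoid ℓ e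
  hom-setoid A B = record { Carrier = Hom A B ; _≈_ = _≈_ ; isEquivalence = ≈-equiv }

  module ≈ {A B : Obj} = IsEquivalence (≈-equiv {A} {B})
  module HomReasoning {A B : Obj} = SetoidReasoning (hom-setoid A B)

  ∘-resp-≈ˡ : ∀ {A B D} {f f' : Hom B D} {g : Hom A B} → f ≈ f' → f ∘ g ≈ f' ∘ g
  ∘-resp-≈ˡ p = ∘-resp-≈ p ≈.refl

  ∘-resp-≈ʳ : ∀ {A B D} {f : Hom B D} {g g' : Hom A B} → g ≈ g' → f ∘ g ≈ f ∘ g'
  ∘-resp-≈ʳ p = ∘-resp-≈ ≈.refl p

  pullˡ : ∀ {A B D E} {f : Hom A B} {g : Hom B D} {h : Hom D E} {k : Hom B E} →
          h ∘ g ≈ k → h ∘ (g ∘ f) ≈ k ∘ f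
  pullˡ p = ≈.trans (≈.sym assoc) (∘-resp-≈ˡ p)

module CoproductFacts {o ℓ e : Level} (C : Category o ℓ e) (CP : FiniteCoproducts C) where
  open Category C
  open FiniteCoproducts CP hiding (⊥)
  open CategoryFacts C

  []-inl : ∀ {A B W} {f : Hom A W} {g : Hom B W} → [ f , g ] ∘ inl ≈ f
  []-inl = IsCoproduct.inject₁ +-isCoproduct

  []-inr : ∀ {A B W} {f : Hom A W} {g : Hom B W} → [ f , g ] ∘ inr ≈ g
  []-inr = IsCoproduct.inject₂ +-isCoproduct

  []-cong₂ : ∀ {A B W} {f f' : Hom A W} {g g' : Hom B W} →
             f ≈ f' → g ≈ g' → [ f , g ] ≈ [ f' , g' ]
  []-cong₂ p q = IsCoproduct.unique +-isCoproduct (≈.trans []-inl p) (≈.trans []-inr q)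

  ∘-[] : ∀ {A B W V} {f : Hom A W} {g : Hom B W} {h : Hom W V} →
         h ∘ [ f , g ] ≈ [ h ∘ f , h ∘ g ]
  ∘-[] = IsCoproduct.unique +-isCoproduct
           (≈.trans assoc (∘-resp-≈ʳ []-inl)) (≈.trans assoc (∘-resp-≈ʳ []-inr))

module KleisliFacts {o ℓ e : Level} (C : Category o ℓ e) (CP : FiniteCoproducts C)
                    (𝕋 : KleisliTriple C) where
  open Category C
  open FiniteCoproducts CP hiding (⊥)
  open KleisliTriple 𝕋
  open CategoryFacts C
  open CoproductFacts C CP

  *-∘-η∘ : ∀ {A B D} {u : Hom B (T D)} {v : Hom A B} → u * ∘ (η ∘ v) ≈ u ∘ v
  *-∘-η∘ = pullˡ *-η

  *-∘-*-∘ : ∀ {A B D E} {f : Hom A (T B)} {g : Hom B (T D)} {h : Hom E (T A)} →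
            g * ∘ (f * ∘ h) ≈ (g * ∘ f) * ∘ h
  *-∘-*-∘ = pullˡ *-∘

  []*-∘-[η∘inl,-] : ∀ {A B D V} {a : Hom A (T V)} {b : Hom B (T V)} {c : Hom D (T (A + B))} →
                    [ a , b ] * ∘ [ η ∘ inl , c ] ≈ [ a , [ a , b ] * ∘ c ]
  []*-∘-[η∘inl,-] = ≈.trans ∘-[] ([]-cong₂ (≈.trans *-∘-η∘ []-inl) ≈.refl)

module WeakGuardedness {o ℓ e : Level} (C : Category o ℓ e) (CP : FiniteCoproducts C)
                       (I : IdealizedMonad C) where
  open Category C
  open FiniteCoproducts CP hiding (⊥)
  open IdealizedMonad I
  open CategoryFacts C
  open CoproductFacts C CP
  open KleisliFacts C CP monad

  collapse : ∀ {Y Z} (σ : Summand C Z Y) → Hom (T (Summand.Y' σ + M Y)) (T Y)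
  collapse σ = [ η ∘ Summand.σ̄ σ , m ] *

  *-∘-m∘° : ∀ {A B D} {k : Hom A (T B)} {l : Hom D (T A)} → k * ∘ (m ∘ l °) ≈ m ∘ (k * ∘ l) °
  *-∘-m∘° {k = k} = ≈.trans (pullˡ (≈.sym (commute k))) (≈.trans assoc (∘-resp-≈ʳ °-∘))

  []*-∘-collapse-inr : ∀ {A B V} {a : Hom A (T V)} {b : Hom B (T V)} →
                       [ a , b ] * ∘ collapse (inrSummand C CP) ≈ [ a , m ∘ [ a , b ] ° ] *
  []*-∘-collapse-inr {a = a} {b} = ≈.trans *-∘ (*-resp-≈ (≈.trans []*-∘-[η∘inl,-]
                                     ([]-cong₂ ≈.refl (≈.sym (commute [ a , b ])))))

  module _ {Y Z : Obj} (σ : Summand C Z Y) where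
    open Summand σ using (σ̄)

    weaklyGuarded-resp-≈ : ∀ {X} {f f' : Hom X (T Y)} →
                           f ≈ f' → WeaklyGuarded C CP I σ f' → WeaklyGuarded C CP I σ f
    weaklyGuarded-resp-≈ p (g , q) = g , ≈.trans p q

    weaklyGuarded-η∘σ̄ : WeaklyGuarded C CP I σ (η ∘ σ̄)
    weaklyGuarded-η∘σ̄ = η ∘ inl , ≈.sym (≈.trans *-∘-η∘ []-inl)

    weaklyGuarded-m∘ : ∀ {X} (k : Hom X (M Y)) → WeaklyGuarded C CP I σ (m ∘ k)
    weaklyGuarded-m∘ k = η ∘ (inr ∘ k) , ≈.sym (≈.trans *-∘-η∘ (pullˡ []-inr))

    weaklyGuarded-[] : ∀ {A B} {f : Hom A (T Y)} {g : Hom B (T Y)} →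
                       WeaklyGuarded C CP I σ f → WeaklyGuarded C CP I σ g →
                       WeaklyGuarded C CP I σ [ f , g ]
    weaklyGuarded-[] (f' , p) (g' , q) = [ f' , g' ] , ≈.trans ([]-cong₂ p q) (≈.sym ∘-[])

    weaklyGuarded-*∘ : ∀ {A B} {u : Hom A (T Y)} → WeaklyGuarded C CP I σ u →
                       (f : Hom B (T A)) → WeaklyGuarded C CP I σ (u * ∘ f)
    weaklyGuarded-*∘ {u = u} (u' , p) f = u' * ∘ f , (begin
        u * ∘ f                 ≈⟨ ∘-resp-≈ˡ (*-resp-≈ p) ⟩
        (collapse σ ∘ u') * ∘ f ≈⟨ *-∘-*-∘ ⟨
        collapse σ ∘ (u' * ∘ f) ∎)
      where open HomReasoning

  weaklyGuarded-[]*∘ : ∀ {X A B V W} (σ : Summand C W V) {f : Hom X (T (A + B))}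
                       {g : Hom A (T V)} {h : Hom B (T V)} →
                       WeaklyGuarded C CP I (inrSummand C CP) f → WeaklyGuarded C CP I σ g →
                       WeaklyGuarded C CP I σ ([ g , h ] * ∘ f)
  weaklyGuarded-[]*∘ σ {f} {g} {h} (f' , f≈) g-guarded =
    weaklyGuarded-resp-≈ σ unfold
      (weaklyGuarded-*∘ σ (weaklyGuarded-[] σ g-guarded (weaklyGuarded-m∘ σ ([ g , h ] °))) f')
    where
    open HomReasoning
    unfold : [ g , h ] * ∘ f ≈ [ g , m ∘ [ g , h ] ° ] * ∘ f'
    unfold = begin
      [ g , h ] * ∘ f                                 ≈⟨ ∘-resp-≈ʳ f≈ ⟩
      [ g , h ] * ∘ (collapse (inrSummand C CP) ∘ f') ≈⟨ pullˡ []*-∘-collapse-inr ⟩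
      [ g , m ∘ [ g , h ] ° ] * ∘ f'                  ∎

  isAbstractGuardedness : IsAbstractGuardedness C CP monad (WeaklyGuarded C CP I)
  isAbstractGuardedness = record
    { trv = weaklyGuarded-*∘ (inrSummand C CP) (weaklyGuarded-η∘σ̄ (inrSummand C CP))
    ; par = λ {σ = σ} → weaklyGuarded-[] σ
    ; cmp = λ {σ = σ} → weaklyGuarded-[]*∘ σ
    }

  guarded-m∘ : ∀ {X Y Z} (k : Hom X (M (Y + Z))) → Guarded C CP I (m ∘ k)
  guarded-m∘ k = inr ∘ k , ≈.sym (pullˡ []-inr)

  module InrGuardedSystem {X Y : Obj} (f : Hom X (T (Y + X))) (g : Hom X (T (Y + M (Y + X))))
                          (f≈ : f ≈ collapse (inrSummand C CP) ∘ g) where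
    h : Hom (M (Y + X)) (T (Y + M (Y + X)))
    h = m ∘ [ η ∘ inl , g ] °

    unfold-f : ∀ s → [ η , s ] * ∘ f ≈ [ η , m ∘ [ η , s ] ° ] * ∘ g
    unfold-f s = ≈.trans (∘-resp-≈ʳ f≈) (pullˡ []*-∘-collapse-inr)

    unfold-h : ∀ t → [ η , t ] * ∘ h ≈ m ∘ [ η , [ η , t ] * ∘ g ] °
    unfold-h t = ≈.trans *-∘-m∘° (∘-resp-≈ʳ (°-resp-≈ []*-∘-[η∘inl,-]))

    solution-f-unfold : ∀ {s} → IsSolution C CP I f s → s ≈ [ η , m ∘ [ η , s ] ° ] * ∘ g
    solution-f-unfold {s} p = ≈.trans p (unfold-f s)

    solution-h : ∀ {s} → IsSolution C CP I f s → IsSolution C CP I h (m ∘ [ η , s ] °)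
    solution-h p = ≈.trans (∘-resp-≈ʳ (°-resp-≈ ([]-cong₂ ≈.refl (solution-f-unfold p))))
                           (≈.sym (unfold-h _))

    solution-f : ∀ {t} → IsSolution C CP I h t → IsSolution C CP I f ([ η , t ] * ∘ g)
    solution-f {t} p = ≈.sym (≈.trans (unfold-f _)
      (∘-resp-≈ˡ (*-resp-≈ ([]-cong₂ ≈.refl (≈.sym (≈.trans p (unfold-h t)))))))

    uniqueSolution : HasUniqueSolution C CP I h → HasUniqueSolution C CP I f
    uniqueSolution (t , t-solution , t-unique) =
      [ η , t ] * ∘ g , solution-f t-solution ,
      λ s p → ≈.trans (solution-f-unfold p)
                (∘-resp-≈ˡ (*-resp-≈ ([]-cong₂ ≈.refl (t-unique _ (solution-h p)))))

  weaklyGuarded-uniqueSolution : CompletelyIterative C CP I →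
    ∀ {X Y} (f : Hom X (T (Y + X))) →
    WeaklyGuarded C CP I (inrSummand C CP) f → HasUniqueSolution C CP I f
  weaklyGuarded-uniqueSolution iterative f (g , f≈) = uniqueSolution (iterative h (guarded-m∘ _))
    where open InrGuardedSystem f g f≈

module WeakGuardednessPreservation {o ℓ e : Level} (C : Category o ℓ e) (CP : FiniteCoproducts C)
                                   {I J : IdealizedMonad C} (αβ : IdealizedMonadMorphism C I J)
                                   where
  open Category C
  open FiniteCoproducts CP hiding (⊥)
  private
    module I = IdealizedMonad I
    module J = IdealizedMonad J
  open IdealizedMonadMorphism αβ
  open CategoryFacts C
  open CoproductFacts C CP
  open WeakGuardedness C CP J

  α-∘-collapse : ∀ {Y Z} (σ : Summand C Z Y) →
                 α ∘ WeakGuardedness.collapse C CP I σ ≈ [ J.η ∘ Summand.σ̄ σ , J.m ∘ β ] J.* ∘ α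
  α-∘-collapse σ = ≈.trans (mult _) (∘-resp-≈ˡ (J.*-resp-≈ (≈.trans ∘-[] ([]-cong₂ (pullˡ unit) α-m))))

  weaklyGuarded-α∘ : ∀ {X Y Z} (σ : Summand C Z Y) (f : Hom X (I.T Y)) →
                     WeaklyGuarded C CP I σ f → WeaklyGuarded C CP J σ (α ∘ f)
  weaklyGuarded-α∘ σ f (g , f≈) =
    weaklyGuarded-resp-≈ σ (≈.trans (∘-resp-≈ʳ f≈) (≈.trans (pullˡ (α-∘-collapse σ)) assoc))
      (weaklyGuarded-*∘ σ (weaklyGuarded-[] σ (weaklyGuarded-η∘σ̄ σ) (weaklyGuarded-m∘ σ β)) (α ∘ g))

theorem3p17 : ∀ {o ℓ e : Level} (C : Category o ℓ e) (CP : FiniteCoproducts C)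
    (I : IdealizedMonad C) →
    IsAbstractGuardedness C CP (IdealizedMonad.monad I) (WeaklyGuarded C CP I)
    × (CompletelyIterative C CP I →
    ∀ {X Y} (f : Category.Hom C X (IdealizedMonad.T I (FiniteCoproducts._+_ CP Y X))) →
    WeaklyGuarded C CP I (inrSummand C CP) f → HasUniqueSolution C CP I f)
    × (∀ (J : IdealizedMonad C) (αβ : IdealizedMonadMorphism C I J) →
    ∀ {X Y Z} (σ : Summand C Z Y) (f : Category.Hom C X (IdealizedMonad.T I Y)) →
    WeaklyGuarded C CP I σ f →
    WeaklyGuarded C CP J σ (Category._∘_ C (IdealizedMonadMorphism.α αβ) f))
theorem3p17 C CP I =
  WeakGuardedness.isAbstractGuardedness C CP I ,
  WeakGuardedness.weaklyGuarded-uniqueSolution C CP I ,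
  λ J αβ → WeakGuardednessPreservation.weaklyGuarded-α∘ C CP αβ
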